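{- The Levi graph $LG_2$ does not have a proper distinguishing monochromatic $3$-coloring.
   Context: Let $V=\mathbb{F}_2^3$. The Levi graph $LG_2$ is the bipartite graph with vertex set $\mathcal{P}\cup\mathcal{L}$, where $\mathcal{P}$ is the set of $1$-dimensional subspaces of $V$ and $\mathcal{L}$ the set of $2$-dimensional subspaces, with $p\in\mathcal{P}$ adjacent to $l\in\mathcal{L}$ iff $p\subseteq l$. A coloring of $LG_2$ is monochromatic if all vertices of $\mathcal{P}$ receive the same color or all vertices of $\mathcal{L}$ receive the same color. A proper coloring is distinguishing if the only automorphism of the graph mapping every color class onto itself is the identity. -}

module Defs where

open import Data.Bool using (Bool; true; false; _∧_; _∨_; not; _xor_; T; if_then_else_)
open import Data.Nat using (ℕ; zero; suc; _+_; _*_; _≡ᵇ_; s≤s; z≤n)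
open import Data.Fin using (Fin; fromℕ<)
open import Data.Vec using (Vec; []; _∷_; lookup)
open import Data.List using (List; []; _∷_; length; filter; map)
open import Data.Product using (Σ; _×_; _,_)
open import Data.Sum using (_⊎_; inj₁; inj₂)
open import Data.Empty using (⊥)
open import Relation.Binary.PropositionalEquality using (_≡_)
open import Relation.Nullary using (¬_)

V : Set
V = Vec Bool 3

_+V_ : V → V → V
(a ∷ b ∷ c ∷ []) +V (a' ∷ b' ∷ c' ∷ []) = (a xor a') ∷ (b xor b') ∷ (c xor c') ∷ []

0V : V
0V = false ∷ false ∷ false ∷ []

allᵇ : {A : Set} → (A → Bool) → List A → Bool
allᵇ p [] = true
allᵇ p (x ∷ xs) = p x ∧ allᵇ p xs

allV : List V
allV = (false ∷ false ∷ false ∷ []) ∷ (false ∷ false ∷ true ∷ []) ∷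
       (false ∷ true ∷ false ∷ []) ∷ (false ∷ true ∷ true ∷ []) ∷
       (true ∷ false ∷ false ∷ []) ∷ (true ∷ false ∷ true ∷ []) ∷
       (true ∷ true ∷ false ∷ []) ∷ (true ∷ true ∷ true ∷ []) ∷ []

index : V → Fin 8
index (a ∷ b ∷ c ∷ []) = fromℕ< {bit a * 4 + bit b * 2 + bit c} (bound a b c)
  where
  bit : Bool → ℕ
  bit false = 0
  bit true  = 1
  bound : ∀ a b c → bit a * 4 + bit b * 2 + bit c Data.Nat.< 8
  bound false false false = s≤s z≤n
  bound false false true  = s≤s (s≤s z≤n)
  bound false true  false = s≤s (s≤s (s≤s z≤n))
  bound false true  true  = s≤s (s≤s (s≤s (s≤s z≤n)))
  bound true  false false = s≤s (s≤s (s≤s (s≤s (s≤s z≤n))))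
  bound true  false true  = s≤s (s≤s (s≤s (s≤s (s≤s (s≤s z≤n)))))
  bound true  true  false = s≤s (s≤s (s≤s (s≤s (s≤s (s≤s (s≤s z≤n))))))
  bound true  true  true  = s≤s (s≤s (s≤s (s≤s (s≤s (s≤s (s≤s (s≤s z≤n)))))))

-- A subset of V, given by its characteristic vector (indexed via `index`).
SubsetV : Set
SubsetV = Vec Bool 8

_∈ᵇ_ : V → SubsetV → Bool
v ∈ᵇ S = lookup S (index v)

-- Boolean test: S is a linear subspace of V over 𝔽₂
-- (contains 0 and is closed under addition; scalar closure is automatic over 𝔽₂).
isSubspace : SubsetV → Bool
isSubspace S = (0V ∈ᵇ S) ∧ allᵇ (λ u → allᵇ (λ v → not (u ∈ᵇ S ∧ v ∈ᵇ S) ∨ ((u +V v) ∈ᵇ S)) allV) allV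

card : SubsetV → ℕ
card S = length (filter (λ v → T? (v ∈ᵇ S)) allV)
  where
  open import Relation.Nullary.Decidable using (Dec)
  open import Data.Bool.Properties using (T?)

-- A subspace of 𝔽₂³ has dimension k iff it has 2^k elements.
isSubspaceOfDim : ℕ → SubsetV → Bool
isSubspaceOfDim k S = isSubspace S ∧ (card S ≡ᵇ (2 Data.Nat.^ k))

Point : Set
Point = Σ SubsetV (λ S → T (isSubspaceOfDim 1 S))

Line : Set
Line = Σ SubsetV (λ S → T (isSubspaceOfDim 2 S))

_⊆ᵇ_ : SubsetV → SubsetV → Bool
S ⊆ᵇ S' = allᵇ (λ v → not (v ∈ᵇ S) ∨ (v ∈ᵇ S')) allV

Vertex : Set
Vertex = Point ⊎ Line

Adj : Vertex → Vertex → Set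
Adj (inj₁ (p , _)) (inj₂ (l , _)) = T (p ⊆ᵇ l)
Adj (inj₂ (l , _)) (inj₁ (p , _)) = T (p ⊆ᵇ l)
Adj (inj₁ _) (inj₁ _) = ⊥
Adj (inj₂ _) (inj₂ _) = ⊥

record Automorphism : Set where
  field
    to       : Vertex → Vertex
    from     : Vertex → Vertex
    to-from  : ∀ x → to (from x) ≡ x
    from-to  : ∀ x → from (to x) ≡ x
    adj-pres : ∀ x y → (Adj x y → Adj (to x) (to y)) × (Adj (to x) (to y) → Adj x y)

Coloring : ℕ → Set
Coloring k = Vertex → Fin k

Proper : ∀ {k} → Coloring k → Set
Proper c = ∀ x y → Adj x y → ¬ (c x ≡ c y)

Monochromatic : ∀ {k} → Coloring k → Set
Monochromatic c = (∀ p q → c (inj₁ p) ≡ c (inj₁ q)) ⊎ (∀ l m → c (inj₂ l) ≡ c (inj₂ m))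

-- Distinguishing: the only automorphism mapping every color class onto itself
-- (i.e. preserving the color of every vertex) is the identity.
Distinguishing : ∀ {k} → Coloring k → Set
Distinguishing c = (σ : Automorphism) → (∀ x → c (Automorphism.to σ x) ≡ c x) → ∀ x → Automorphism.to σ x ≡ x

module Submission where

-- Every point lies on a line, so in a proper colouring whose lines share one colour the points use
-- only the two remaining colours; the duality of the Fano plane swapping points and lines reduces the
-- other case to this one. A 2-colouring of the seven points has a nontrivial stabilizer in GL₃(𝔽₂)
-- (its orbit has at most 35 elements, the group 168), which always contains a transvection; that
-- transvection is a colour-preserving automorphism of LG₂ other than the identity.

open import Defs
open import Data.Bool using (Bool; T; not; _∧_; _∨_; _xor_; if_then_else_)
open import Data.Bool.Properties using (T?; T-irrelevant) renaming (_≟_ to _≟ᵇ_)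
open import Data.Fin using (Fin; zero; suc; _≟_)
open import Data.Fin.Properties using (all?; any?)
open import Data.Fin.Subset using (Subset)
open import Data.Fin.Subset.Properties using (anySubset?)
open import Data.Product using (Σ; ∃; ∃₂; _×_; _,_; proj₁; proj₂)
open import Data.Product.Properties using (Σ-≡,≡→≡)
open import Data.Sum using (inj₁; inj₂)
open import Data.Sum.Properties using (inj₁-injective)
open import Data.Vec using ([]; _∷_; lookup; tabulate; fromList)
open import Data.Vec.Properties using (lookup∘tabulate) renaming (≡-dec to ≡-decⱽ)
open import Function using (_∘_; _↔_; mk↔ₛ′; Inverse)
open import Relation.Binary.PropositionalEquality using (_≡_; _≢_; refl; sym; trans; cong; cong₂; subst; subst₂; module ≡-Reasoning)
open import Relation.Nullary using (¬_; Dec; yes; no; does; ¬?)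
open import Relation.Nullary.Decidable using (map′; from-yes; decidable-stable; _×-dec_; _→-dec_)
open import Relation.Unary using (Decidable)

open Automorphism

all-subsets? : ∀ {n} {P : Subset n → Set} → Decidable P → Dec (∀ S → P S)
all-subsets? P? = map′ (λ ¬∃¬P S → decidable-stable (P? S) (λ ¬PS → ¬∃¬P (S , ¬PS)))
                       (λ ∀P (S , ¬PS) → ¬PS (∀P S))
                       (¬? (anySubset? (¬? ∘ P?)))

module _ {A : Set} {b : A → Bool} {n} (e : Fin n → A) (valid : ∀ i → T (b (e i)))
         (injective : ∀ i j → e i ≡ e j → i ≡ j) (cover : ∀ x → T (b x) → ∃ λ i → x ≡ e i) where

  enumeration : Σ A (T ∘ b) ↔ Fin n
  enumeration = mk↔ₛ′ position (λ i → e i , valid i) position-e e-position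
    where
    position : Σ A (T ∘ b) → Fin n
    position (x , bx) = proj₁ (cover x bx)

    position-e : ∀ i → position (e i , valid i) ≡ i
    position-e i = injective _ _ (sym (proj₂ (cover (e i) (valid i))))

    e-position : ∀ p → (e (position p) , valid (position p)) ≡ p
    e-position (x , bx) = Σ-≡,≡→≡ (sym (proj₂ (cover x bx)) , T-irrelevant _ _)

_==_ : V → V → Bool
u == w = does (≡-decⱽ _≟ᵇ_ u w)

_·_ : V → V → Bool
(a ∷ b ∷ c ∷ []) · (a′ ∷ b′ ∷ c′ ∷ []) = (a ∧ a′) xor (b ∧ b′) xor (c ∧ c′)

-- Inverse to `index`, as allV is listed in index order.
vector : Fin 8 → V
vector = lookup (fromList allV)

nonzero : Fin 7 → V
nonzero = vector ∘ suc

-- 0V, which has no index here, is sent to the junk value zero.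
nonzeroIndex : V → Fin 7
nonzeroIndex u with index u
... | zero  = zero
... | suc i = i

subsetOf : (V → Bool) → SubsetV
subsetOf p = tabulate (p ∘ vector)

pointSubspace : Fin 7 → SubsetV
pointSubspace i = subsetOf (λ u → u == 0V ∨ u == nonzero i)

-- Lines are indexed by their normal vectors, so incidence is orthogonality and hence symmetric.
lineSubspace : Fin 7 → SubsetV
lineSubspace j = subsetOf (λ u → not (nonzero j · u))

incident : Fin 7 → Fin 7 → Bool
incident i j = pointSubspace i ⊆ᵇ lineSubspace j

-- Proofs by evaluation are kept abstract so that their large normal forms are never unfolded.
abstract
  incident-sym : ∀ i j → incident i j ≡ incident j i
  incident-sym = from-yes (all? λ i → all? λ j → incident i j ≟ᵇ incident j i)

  pointSubspace-valid : ∀ i → T (isSubspaceOfDim 1 (pointSubspace i))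
  pointSubspace-valid = from-yes (all? λ i → T? (isSubspaceOfDim 1 (pointSubspace i)))

  pointSubspace-injective : ∀ i j → pointSubspace i ≡ pointSubspace j → i ≡ j
  pointSubspace-injective = from-yes (all? λ i → all? λ j → ≡-decⱽ _≟ᵇ_ (pointSubspace i) (pointSubspace j) →-dec i ≟ j)

  pointSubspace-cover : ∀ S → T (isSubspaceOfDim 1 S) → ∃ λ i → S ≡ pointSubspace i
  pointSubspace-cover = from-yes (all-subsets? λ S → T? (isSubspaceOfDim 1 S) →-dec any? λ i → ≡-decⱽ _≟ᵇ_ S (pointSubspace i))

  lineSubspace-valid : ∀ j → T (isSubspaceOfDim 2 (lineSubspace j))
  lineSubspace-valid = from-yes (all? λ j → T? (isSubspaceOfDim 2 (lineSubspace j)))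

  lineSubspace-injective : ∀ i j → lineSubspace i ≡ lineSubspace j → i ≡ j
  lineSubspace-injective = from-yes (all? λ i → all? λ j → ≡-decⱽ _≟ᵇ_ (lineSubspace i) (lineSubspace j) →-dec i ≟ j)

  lineSubspace-cover : ∀ S → T (isSubspaceOfDim 2 S) → ∃ λ j → S ≡ lineSubspace j
  lineSubspace-cover = from-yes (all-subsets? λ S → T? (isSubspaceOfDim 2 S) →-dec any? λ j → ≡-decⱽ _≟ᵇ_ S (lineSubspace j))

points : Point ↔ Fin 7
points = enumeration pointSubspace pointSubspace-valid pointSubspace-injective pointSubspace-cover

lines : Line ↔ Fin 7
lines = enumeration lineSubspace lineSubspace-valid lineSubspace-injective lineSubspace-cover

point : Fin 7 → Point
point = Inverse.from points

pointIndex : Point → Fin 7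
pointIndex = Inverse.to points

line : Fin 7 → Line
line = Inverse.from lines

lineIndex : Line → Fin 7
lineIndex = Inverse.to lines

pointIndex∘point : ∀ i → pointIndex (point i) ≡ i
pointIndex∘point = Inverse.strictlyInverseˡ points

point∘pointIndex : ∀ p → point (pointIndex p) ≡ p
point∘pointIndex = Inverse.strictlyInverseʳ points

lineIndex∘line : ∀ j → lineIndex (line j) ≡ j
lineIndex∘line = Inverse.strictlyInverseˡ lines

line∘lineIndex : ∀ l → line (lineIndex l) ≡ l
line∘lineIndex = Inverse.strictlyInverseʳ lines

⊆ᵇ-incident : ∀ (p : Point) (l : Line) → (proj₁ p ⊆ᵇ proj₁ l) ≡ incident (pointIndex p) (lineIndex l)
⊆ᵇ-incident p l = cong₂ (λ p l → proj₁ p ⊆ᵇ proj₁ l) (sym (point∘pointIndex p)) (sym (line∘lineIndex l))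

involution : (f : Vertex → Vertex) → (∀ x → f (f x) ≡ x) → (∀ x y → Adj x y → Adj (f x) (f y)) → Automorphism
involution f f∘f preserves = record
  { to = f ; from = f ; to-from = f∘f ; from-to = f∘f
  ; adj-pres = λ x y → preserves x y , λ adj → subst₂ Adj (f∘f x) (f∘f y) (preserves (f x) (f y) adj) }

_∘ᴬ_ : Automorphism → Automorphism → Automorphism
σ ∘ᴬ ρ = record
  { to = to σ ∘ to ρ
  ; from = from ρ ∘ from σ
  ; to-from = λ x → trans (cong (to σ) (to-from ρ (from σ x))) (to-from σ x)
  ; from-to = λ x → trans (cong (from ρ) (from-to σ (to ρ x))) (from-to ρ x)
  ; adj-pres = λ x y → proj₁ (adj-pres σ (to ρ x) (to ρ y)) ∘ proj₁ (adj-pres ρ x y)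
                     , proj₂ (adj-pres ρ x y) ∘ proj₂ (adj-pres σ (to ρ x) (to ρ y)) }

_⁻¹ᴬ : Automorphism → Automorphism
σ ⁻¹ᴬ = record
  { to = from σ ; from = to σ ; to-from = from-to σ ; from-to = to-from σ
  ; adj-pres = λ x y → (λ adj → proj₂ (adj-pres σ (from σ x) (from σ y)) (subst₂ Adj (sym (to-from σ x)) (sym (to-from σ y)) adj))
                     , (λ adj → subst₂ Adj (to-from σ x) (to-from σ y) (proj₁ (adj-pres σ (from σ x) (from σ y)) adj)) }

Proper-∘ : ∀ {k} {c : Coloring k} (σ : Automorphism) → Proper c → Proper (c ∘ to σ)
Proper-∘ σ proper x y adj = proper (to σ x) (to σ y) (proj₁ (adj-pres σ x y) adj)

Distinguishing-∘ : ∀ {k} {c : Coloring k} (σ : Automorphism) → Distinguishing c → Distinguishing (c ∘ to σ)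
Distinguishing-∘ {c = c} σ distinguishing ρ preserves x = begin
  to ρ x                                  ≡⟨ sym (to-from (σ ⁻¹ᴬ) (to ρ x)) ⟩
  from σ (to σ (to ρ x))                  ≡⟨ cong (from σ ∘ to σ ∘ to ρ) (sym (from-to σ x)) ⟩
  from σ (to conjugate (to σ x))          ≡⟨ cong (from σ) (distinguishing conjugate conjugate-preserves (to σ x)) ⟩
  from σ (to σ x)                         ≡⟨ from-to σ x ⟩
  x                                       ∎
  where
  open ≡-Reasoning
  conjugate : Automorphism
  conjugate = σ ∘ᴬ (ρ ∘ᴬ (σ ⁻¹ᴬ))
  conjugate-preserves : ∀ y → c (to conjugate y) ≡ c y
  conjugate-preserves y = trans (preserves (from σ y)) (cong c (to-from σ y))

duality : Automorphism
duality = involution δ δ∘δ preserves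
  where
  δ : Vertex → Vertex
  δ (inj₁ p) = inj₂ (line (pointIndex p))
  δ (inj₂ l) = inj₁ (point (lineIndex l))

  δ∘δ : ∀ x → δ (δ x) ≡ x
  δ∘δ (inj₁ p) = cong inj₁ (trans (cong point (lineIndex∘line _)) (point∘pointIndex p))
  δ∘δ (inj₂ l) = cong inj₂ (trans (cong line (pointIndex∘point _)) (line∘lineIndex l))

  dual-incidence : ∀ p l → (proj₁ p ⊆ᵇ proj₁ l) ≡ incident (lineIndex l) (pointIndex p)
  dual-incidence p l = trans (⊆ᵇ-incident p l) (incident-sym (pointIndex p) (lineIndex l))

  preserves : ∀ x y → Adj x y → Adj (δ x) (δ y)
  preserves (inj₁ p) (inj₂ l) = subst T (dual-incidence p l)
  preserves (inj₂ l) (inj₁ p) = subst T (dual-incidence p l)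

record IsInvolutiveCollineation (π τ : Fin 7 → Fin 7) : Set where
  field
    π-involutive        : ∀ i → π (π i) ≡ i
    τ-involutive        : ∀ j → τ (τ j) ≡ j
    preserves-incidence : ∀ i j → incident (π i) (τ j) ≡ incident i j
    moves-a-point       : ∃ λ i → π i ≢ i

isInvolutiveCollineation? : ∀ π τ → Dec (IsInvolutiveCollineation π τ)
isInvolutiveCollineation? π τ =
  map′ (λ (π² , τ² , inc , moves) → record { π-involutive = π² ; τ-involutive = τ² ; preserves-incidence = inc ; moves-a-point = moves })
       (λ c → let open IsInvolutiveCollineation c in π-involutive , τ-involutive , preserves-incidence , moves-a-point)
       (all? (λ i → π (π i) ≟ i) ×-dec all? (λ j → τ (τ j) ≟ j)
         ×-dec all? (λ i → all? λ j → incident (π i) (τ j) ≟ᵇ incident i j) ×-dec any? (λ i → ¬? (π i ≟ i)))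

module _ {π τ : Fin 7 → Fin 7} (isCollineation : IsInvolutiveCollineation π τ) where
  open IsInvolutiveCollineation isCollineation

  private
    act : Vertex → Vertex
    act (inj₁ p) = inj₁ (point (π (pointIndex p)))
    act (inj₂ l) = inj₂ (line (τ (lineIndex l)))

    act∘act : ∀ x → act (act x) ≡ x
    act∘act (inj₁ p) = cong inj₁ (begin
      point (π (pointIndex (point (π (pointIndex p))))) ≡⟨ cong (point ∘ π) (pointIndex∘point _) ⟩
      point (π (π (pointIndex p)))                      ≡⟨ cong point (π-involutive _) ⟩
      point (pointIndex p)                              ≡⟨ point∘pointIndex p ⟩
      p                                                 ∎)
      where open ≡-Reasoning
    act∘act (inj₂ l) = cong inj₂ (begin
      line (τ (lineIndex (line (τ (lineIndex l))))) ≡⟨ cong (line ∘ τ) (lineIndex∘line _) ⟩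
      line (τ (τ (lineIndex l)))                    ≡⟨ cong line (τ-involutive _) ⟩
      line (lineIndex l)                            ≡⟨ line∘lineIndex l ⟩
      l                                             ∎)
      where open ≡-Reasoning

    act-incidence : ∀ p l → (proj₁ p ⊆ᵇ proj₁ l) ≡ incident (π (pointIndex p)) (τ (lineIndex l))
    act-incidence p l = trans (⊆ᵇ-incident p l) (sym (preserves-incidence (pointIndex p) (lineIndex l)))

    preserves : ∀ x y → Adj x y → Adj (act x) (act y)
    preserves (inj₁ p) (inj₂ l) = subst T (act-incidence p l)
    preserves (inj₂ l) (inj₁ p) = subst T (act-incidence p l)

  collineation : Automorphism
  collineation = involution act act∘act preserves

  collineation-nontrivial : ∃ λ x → to collineation x ≢ x
  collineation-nontrivial with moves-a-point
  ... | i , πi≢i = inj₁ (point i) , λ eq → πi≢i (begin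
    π i                                   ≡⟨ cong π (sym (pointIndex∘point i)) ⟩
    π (pointIndex (point i))              ≡⟨ sym (pointIndex∘point _) ⟩
    pointIndex (point (π (pointIndex (point i)))) ≡⟨ cong pointIndex (inj₁-injective eq) ⟩
    pointIndex (point i)                  ≡⟨ pointIndex∘point i ⟩
    i                                     ∎)
    where open ≡-Reasoning

-- For f · v = 0, shear f v is a transvection and an involution; these 21 maps are all the involutions of GL₃(𝔽₂).
shear : V → V → V → V
shear f v x = if f · x then x +V v else x

orthogonal : Fin 7 → Fin 7 → Bool
orthogonal f v = not (nonzero f · nonzero v)

transvection : Fin 7 → Fin 7 → Fin 7 → Fin 7
transvection f v = nonzeroIndex ∘ shear (nonzero f) (nonzero v) ∘ nonzero

-- On normal vectors of lines the transvection acts by its transpose, which swaps f and v.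
abstract
  transvection-isInvolutiveCollineation : ∀ f v → T (orthogonal f v) → IsInvolutiveCollineation (transvection f v) (transvection v f)
  transvection-isInvolutiveCollineation =
    from-yes (all? λ f → all? λ v → T? (orthogonal f v) →-dec isInvolutiveCollineation? (transvection f v) (transvection v f))

  subset-stabilized-by-transvection : ∀ (S : Subset 7) → ∃₂ λ f v → T (orthogonal f v) × (∀ i → lookup S (transvection f v i) ≡ lookup S i)
  subset-stabilized-by-transvection = from-yes (all-subsets? λ S → any? λ f → any? λ v →
    T? (orthogonal f v) ×-dec all? λ i → lookup S (transvection f v i) ≟ᵇ lookup S i)

stabilizing-collineation : (B : Fin 7 → Bool) → ∃₂ λ π τ → IsInvolutiveCollineation π τ × (∀ i → B (π i) ≡ B i)
stabilizing-collineation B with subset-stabilized-by-transvection (tabulate B)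
... | f , v , f⊥v , stable = transvection f v , transvection v f , transvection-isInvolutiveCollineation f v f⊥v , B∘π≡B
  where
  open ≡-Reasoning
  B∘π≡B : ∀ i → B (transvection f v i) ≡ B i
  B∘π≡B i = begin
    B (transvection f v i)                    ≡⟨ sym (lookup∘tabulate B _) ⟩
    lookup (tabulate B) (transvection f v i)  ≡⟨ stable i ⟩
    lookup (tabulate B) i                     ≡⟨ lookup∘tabulate B i ⟩
    B i                                       ∎

abstract
  fin3-third-unique : ∀ (a b x y : Fin 3) → a ≢ b → x ≢ a → x ≢ b → y ≢ a → y ≢ b → x ≡ y
  fin3-third-unique = from-yes (all? λ (a : Fin 3) → all? λ b → all? λ x → all? λ y →
    ¬? (a ≟ b) →-dec ¬? (x ≟ a) →-dec ¬? (x ≟ b) →-dec ¬? (y ≟ a) →-dec ¬? (y ≟ b) →-dec x ≟ y)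

≡-from-comparison : ∀ {a w x y : Fin 3} → w ≢ a → x ≢ a → y ≢ a → does (x ≟ w) ≡ does (y ≟ w) → x ≡ y
≡-from-comparison {a} {w} {x} {y} w≢a x≢a y≢a same with x ≟ w | y ≟ w
... | yes refl | yes refl = refl
... | no x≢w   | no y≢w   = fin3-third-unique a w x y (w≢a ∘ sym) x≢a x≢w y≢a y≢w
≡-from-comparison w≢a x≢a y≢a () | yes _ | no _
≡-from-comparison w≢a x≢a y≢a () | no _  | yes _

abstract
  point-on-some-line : ∀ i → ∃ λ j → T (incident i j)
  point-on-some-line = from-yes (all? λ i → any? λ j → T? (incident i j))

module _ (c : Coloring 3) (proper : Proper c) (monochromatic : ∀ l m → c (inj₂ l) ≡ c (inj₂ m)) where

  point-avoids-line-colour : ∀ i → c (inj₁ (point i)) ≢ c (inj₂ (line zero))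
  point-avoids-line-colour i eq with point-on-some-line i
  ... | j , i∈j = proper (inj₁ (point i)) (inj₂ (line j)) i∈j (trans eq (monochromatic _ _))

  colour-preserving-collineation : ∃₂ λ π τ → IsInvolutiveCollineation π τ × (∀ i → c (inj₁ (point (π i))) ≡ c (inj₁ (point i)))
  colour-preserving-collineation with stabilizing-collineation (λ i → does (c (inj₁ (point i)) ≟ c (inj₁ (point zero))))
  ... | π , τ , isCollineation , stable = π , τ , isCollineation , λ i →
    ≡-from-comparison (point-avoids-line-colour zero) (point-avoids-line-colour (π i)) (point-avoids-line-colour i) (stable i)

  no-distinguishing-with-monochromatic-lines : ¬ Distinguishing c
  no-distinguishing-with-monochromatic-lines distinguishing with colour-preserving-collineation
  ... | π , τ , isCollineation , colour∘π =
    proj₂ (collineation-nontrivial isCollineation) (distinguishing (collineation isCollineation) preserves _)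
    where
    preserves : ∀ x → c (to (collineation isCollineation) x) ≡ c x
    preserves (inj₁ p) = trans (colour∘π (pointIndex p)) (cong (c ∘ inj₁) (point∘pointIndex p))
    preserves (inj₂ l) = monochromatic _ _

mainTheorem12 : ¬ (Σ (Coloring 3) (λ c → Proper c × Monochromatic c × Distinguishing c))
mainTheorem12 (c , proper , inj₂ linesMonochromatic , distinguishing) =
  no-distinguishing-with-monochromatic-lines c proper linesMonochromatic distinguishing
mainTheorem12 (c , proper , inj₁ pointsMonochromatic , distinguishing) =
  no-distinguishing-with-monochromatic-lines (c ∘ to duality) (Proper-∘ duality proper)
    (λ l m → pointsMonochromatic _ _) (Distinguishing-∘ duality distinguishing)
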